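{- Let $\mathcal{V}$ be a subvariety of $\mathcal{IRL}$ and $t(x)$ a unary term. Then $t(x)$ is a nucleus on $\mathcal{V}$ if and only if $\mathcal{V}\models t(x)\approx s(x)$ for some $s(x)\in\{x,\top\}$ (equivalently, for some $s(x)\in\{\neg\neg x,\top\}$).
   Context: A residuated lattice is an algebra $\mathbf{A}=\langle A,\wedge,\vee,\cdot,\to,\bot,\top\rangle$ such that $\langle A,\wedge,\vee,\bot,\top\rangle$ is a bounded lattice, $\langle A,\cdot,\top\rangle$ is a commutative monoid, and $a\cdot b\le c$ iff $a\le b\to c$. $\neg x:=x\to\bot$. $\mathcal{IRL}$ is the variety of residuated lattices satisfying $x\approx\neg\neg x$. A nucleus on $\mathbf{A}$ is a map $\gamma:A\to A$ with $a\le\gamma(a)$, $a\le b\Rightarrow\gamma(a)\le\gamma(b)$, $\gamma(\gamma(a))=\gamma(a)$ and $\gamma(a)\cdot\gamma(b)\le\gamma(a\cdot b)$. A term $t(x)$ is a nucleus on $\mathcal{V}$ if $t^{\mathbf{A}}$ is a nucleus on $\mathbf{A}$ for every $\mathbf{A}\in\mathcal{V}$. -}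

module Defs where

open import Level using (0ℓ)
open import Data.Nat using (ℕ)
open import Data.Fin using (Fin; zero)
open import Data.Product using (Σ; _×_; _,_)
open import Relation.Binary.Core using (Rel)
open import Algebra.Core using (Op₂)
open import Algebra.Structures using (IsCommutativeMonoid)
open import Algebra.Lattice.Structures using (IsLattice)

record ResLattice : Set₁ where
  infix  4 _≈_ _≤_
  infixr 6 _∧_ _∨_
  infixl 7 _·_
  infixr 5 _⇒_
  field
    Carrier : Set
    _≈_     : Rel Carrier 0ℓ
    _∧_ _∨_ _·_ _⇒_ : Op₂ Carrier
    ⊥ ⊤     : Carrier
    isLattice       : IsLattice _≈_ _∨_ _∧_
    isCommMonoid    : IsCommutativeMonoid _≈_ _·_ ⊤
    ⇒-cong  : ∀ {a a′ b b′} → a ≈ a′ → b ≈ b′ → (a ⇒ b) ≈ (a′ ⇒ b′)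

  _≤_ : Rel Carrier 0ℓ
  a ≤ b = (a ∧ b) ≈ a

  field
    ⊥-least    : ∀ a → ⊥ ≤ a
    ⊤-greatest : ∀ a → a ≤ ⊤
    residuation₁ : ∀ a b c → a · b ≤ c → a ≤ b ⇒ c
    residuation₂ : ∀ a b c → a ≤ b ⇒ c → a · b ≤ c

  ¬_ : Carrier → Carrier
  ¬ a = a ⇒ ⊥

IsInvolutive : ResLattice → Set
IsInvolutive A = ∀ a → a ≈ ¬ (¬ a)
  where open ResLattice A

data Term (n : ℕ) : Set where
  var  : Fin n → Term n
  _∧ₜ_ _∨ₜ_ _·ₜ_ _⇒ₜ_ : Term n → Term n → Term n
  ⊥ₜ ⊤ₜ : Term n

⟦_⟧ : ∀ {n} → Term n → (A : ResLattice) → (Fin n → ResLattice.Carrier A) → ResLattice.Carrier A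
⟦ var i ⟧   A ρ = ρ i
⟦ s ∧ₜ t ⟧ A ρ = ResLattice._∧_ A (⟦ s ⟧ A ρ) (⟦ t ⟧ A ρ)
⟦ s ∨ₜ t ⟧ A ρ = ResLattice._∨_ A (⟦ s ⟧ A ρ) (⟦ t ⟧ A ρ)
⟦ s ·ₜ t ⟧ A ρ = ResLattice._·_ A (⟦ s ⟧ A ρ) (⟦ t ⟧ A ρ)
⟦ s ⇒ₜ t ⟧ A ρ = ResLattice._⇒_ A (⟦ s ⟧ A ρ) (⟦ t ⟧ A ρ)
⟦ ⊥ₜ ⟧     A ρ = ResLattice.⊥ A
⟦ ⊤ₜ ⟧     A ρ = ResLattice.⊤ A

Equation : Set
Equation = Σ ℕ (λ n → Term n × Term n)

_⊨_ : ResLattice → Equation → Set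
A ⊨ (n , s , t) = ∀ (ρ : Fin n → ResLattice.Carrier A) → ResLattice._≈_ A (⟦ s ⟧ A ρ) (⟦ t ⟧ A ρ)

-- A subvariety of IRL, presented (Birkhoff) by a set of extra equations
-- (indexed by I) added to the axioms of IRL.

record Subvariety : Set₁ where
  field
    I   : Set
    eqs : I → Equation

_∈ᵥ_ : ResLattice → Subvariety → Set
A ∈ᵥ V = IsInvolutive A × (∀ i → A ⊨ Subvariety.eqs V i)

eval₁ : Term 1 → (A : ResLattice) → ResLattice.Carrier A → ResLattice.Carrier A
eval₁ t A a = ⟦ t ⟧ A (λ _ → a)

record IsNucleus (A : ResLattice) (γ : ResLattice.Carrier A → ResLattice.Carrier A) : Set where
  open ResLattice A
  field
    extensive   : ∀ a → a ≤ γ a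
    monotone    : ∀ a b → a ≤ b → γ a ≤ γ b
    idempotent  : ∀ a → γ (γ a) ≈ γ a
    mult        : ∀ a b → γ a · γ b ≤ γ (a · b)

NucleusOn : Subvariety → Term 1 → Set₁
NucleusOn V t = ∀ (A : ResLattice) → A ∈ᵥ V → IsNucleus A (eval₁ t A)

_⊨ᵥ_≈_ : Subvariety → Term 1 → Term 1 → Set₁
V ⊨ᵥ t ≈ s = ∀ (A : ResLattice) → A ∈ᵥ V → A ⊨ (1 , t , s)

x₁ ⊤₁ ¬¬x₁ : Term 1
x₁ = var zero
⊤₁ = ⊤ₜ
¬¬x₁ = (var zero ⇒ₜ ⊥ₜ) ⇒ₜ ⊥ₜ

{-# OPTIONS --safe #-}
module Submission where

open import Defs
open import Data.Bool as 𝔹 using (Bool; true; false; not)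
open import Data.Fin using (Fin; zero)
open import Data.Product using (_×_; _,_)
open import Data.Sum using (_⊎_; inj₁; inj₂)
open import Data.Sum.Function.Propositional using (_⊎-⇔_)
open import Function.Bundles using (_⇔_; mk⇔)
open import Function.Construct.Composition using (_⇔-∘_)
open import Function.Construct.Identity using (⇔-id)
open import Algebra.Structures using (IsCommutativeMonoid)
open import Algebra.Lattice.Structures using (IsLattice)
open import Algebra.Lattice.Bundles using (Lattice)
open import Relation.Binary.Structures using (IsPartialOrder)
open import Relation.Binary.Bundles using (Poset)
open import Relation.Binary.PropositionalEquality as ≡ using (_≡_; _≗_)
import Algebra.Definitions as AlgebraDefinitions
import Algebra.Lattice.Properties.Lattice as LatticeProperties
import Relation.Binary.Reasoning.PartialOrder as PosetReasoning

-- In every residuated lattice {⊥, ⊤} is closed under the basic operations and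
-- is an image of the two-element Boolean algebra, so the value t(⊥) is ⊥ or ⊤
-- according to a Boolean computation that does not depend on the algebra.
-- If t(⊥) = ⊤, monotonicity forces a nucleus t to be constantly ⊤.  If
-- t(⊥) = ⊥, then t(a) · ¬a ≤ t(a) · t(¬a) ≤ t(a · ¬a) ≤ t(⊥) = ⊥, so
-- t(a) ≤ ¬¬a = a, and t is the identity.

⟦_⟧𝔹 : ∀ {n} → Term n → (Fin n → Bool) → Bool
⟦ var i ⟧𝔹   ρ = ρ i
⟦ s ∧ₜ t ⟧𝔹 ρ = ⟦ s ⟧𝔹 ρ 𝔹.∧ ⟦ t ⟧𝔹 ρ
⟦ s ∨ₜ t ⟧𝔹 ρ = ⟦ s ⟧𝔹 ρ 𝔹.∨ ⟦ t ⟧𝔹 ρ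
⟦ s ·ₜ t ⟧𝔹 ρ = ⟦ s ⟧𝔹 ρ 𝔹.∧ ⟦ t ⟧𝔹 ρ
⟦ s ⇒ₜ t ⟧𝔹 ρ = not (⟦ s ⟧𝔹 ρ) 𝔹.∨ ⟦ t ⟧𝔹 ρ
⟦ ⊥ₜ ⟧𝔹     ρ = false
⟦ ⊤ₜ ⟧𝔹     ρ = true

valueAt⊥ : Term 1 → Bool
valueAt⊥ t = ⟦ t ⟧𝔹 (λ _ → false)

module ResLatticeProperties (A : ResLattice) where
  open ResLattice A
  open IsLattice isLattice
  open IsCommutativeMonoid isCommMonoid using (comm; identityˡ; ∙-cong)
  open AlgebraDefinitions _≈_ using (LeftIdentity; LeftZero)

  lattice : Lattice _ _
  lattice = record { isLattice = isLattice }

  ≤-isPartialOrder : IsPartialOrder _≈_ _≤_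
  ≤-isPartialOrder = record
    { isPreorder = record
      { isEquivalence = isEquivalence
      ; reflexive     = λ a≈b → sym (L.reflexive a≈b)
      ; trans         = λ a≤b b≤c → sym (L.trans (sym a≤b) (sym b≤c))
      }
    ; antisym = λ a≤b b≤a → L.antisym (sym a≤b) (sym b≤a)
    }
    where
    -- the library's lattice order is  a ≈ a ∧ b, the mirror image of _≤_
    module L = Poset (LatticeProperties.poset lattice)

  poset : Poset _ _ _
  poset = record { isPartialOrder = ≤-isPartialOrder }

  open Poset poset public
    using () renaming (refl to ≤-refl; reflexive to ≤-reflexive; antisym to ≤-antisym)
  open PosetReasoning poset

  ∧-identityˡ : LeftIdentity ⊤ _∧_
  ∧-identityˡ a = trans (∧-comm ⊤ a) (⊤-greatest a)

  ∧-zeroˡ : LeftZero ⊥ _∧_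
  ∧-zeroˡ = ⊥-least

  ∨-identityˡ : LeftIdentity ⊥ _∨_
  ∨-identityˡ a = begin-equality
    ⊥ ∨ a        ≈⟨ ∨-comm ⊥ a ⟩
    a ∨ ⊥        ≈⟨ ∨-congˡ (trans (sym (⊥-least a)) (∧-comm ⊥ a)) ⟩
    a ∨ (a ∧ ⊥)  ≈⟨ ∨-absorbs-∧ a ⊥ ⟩
    a            ∎

  ∨-zeroˡ : LeftZero ⊤ _∨_
  ∨-zeroˡ a = begin-equality
    ⊤ ∨ a        ≈⟨ ∨-congˡ (∧-identityˡ a) ⟨
    ⊤ ∨ (⊤ ∧ a)  ≈⟨ ∨-absorbs-∧ ⊤ a ⟩
    ⊤            ∎

  ·-zeroˡ : LeftZero ⊥ _·_
  ·-zeroˡ a = ≤-antisym (residuation₂ ⊥ a ⊥ (⊥-least (a ⇒ ⊥))) (⊥-least (⊥ · a))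

  ⇒-identityˡ : LeftIdentity ⊤ _⇒_
  ⇒-identityˡ a = ≤-antisym ⊤⇒a≤a
    (residuation₁ a ⊤ a (≤-reflexive (trans (comm a ⊤) (identityˡ a))))
    where
    ⊤⇒a≤a : ⊤ ⇒ a ≤ a
    ⊤⇒a≤a = begin
      ⊤ ⇒ a      ≈⟨ identityˡ (⊤ ⇒ a) ⟨
      ⊤ · (⊤ ⇒ a) ≈⟨ comm ⊤ (⊤ ⇒ a) ⟩
      (⊤ ⇒ a) · ⊤ ≤⟨ residuation₂ (⊤ ⇒ a) ⊤ a ≤-refl ⟩
      a          ∎

  ⊥⇒a≈⊤ : ∀ a → ⊥ ⇒ a ≈ ⊤
  ⊥⇒a≈⊤ a = ≤-antisym (⊤-greatest (⊥ ⇒ a))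
    (residuation₁ ⊤ ⊥ a (begin
      ⊤ · ⊥  ≈⟨ comm ⊤ ⊥ ⟩
      ⊥ · ⊤  ≈⟨ ·-zeroˡ ⊤ ⟩
      ⊥      ≤⟨ ⊥-least a ⟩
      a      ∎))

  ·-monoˡ-≤ : ∀ {a b} c → a ≤ b → a · c ≤ b · c
  ·-monoˡ-≤ {a} {b} c a≤b = residuation₂ a c (b · c) (begin
    a          ≤⟨ a≤b ⟩
    b          ≤⟨ residuation₁ b c (b · c) ≤-refl ⟩
    c ⇒ b · c  ∎)

  ·-monoʳ-≤ : ∀ {a b} c → a ≤ b → c · a ≤ c · b
  ·-monoʳ-≤ {a} {b} c a≤b = begin
    c · a  ≈⟨ comm c a ⟩
    a · c  ≤⟨ ·-monoˡ-≤ c a≤b ⟩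
    b · c  ≈⟨ comm b c ⟩
    c · b  ∎

  a·¬a≤⊥ : ∀ a → a · ¬ a ≤ ⊥
  a·¬a≤⊥ a = begin
    a · ¬ a  ≈⟨ comm a (¬ a) ⟩
    ¬ a · a  ≤⟨ residuation₂ (¬ a) a ⊥ ≤-refl ⟩
    ⊥        ∎

  embed : Bool → Carrier
  embed true  = ⊤
  embed false = ⊥

  embed-homomorphic : ∀ {n} (t : Term n) (ρ : Fin n → Bool) →
                      ⟦ t ⟧ A (λ i → embed (ρ i)) ≈ embed (⟦ t ⟧𝔹 ρ)
  embed-homomorphic (var i)  ρ = refl
  embed-homomorphic (s ∧ₜ t) ρ =
    trans (∧-cong (embed-homomorphic s ρ) (embed-homomorphic t ρ)) (embed-∧ (⟦ s ⟧𝔹 ρ))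
    where
    embed-∧ : ∀ b {c} → embed b ∧ embed c ≈ embed (b 𝔹.∧ c)
    embed-∧ true  = ∧-identityˡ _
    embed-∧ false = ∧-zeroˡ _
  embed-homomorphic (s ∨ₜ t) ρ =
    trans (∨-cong (embed-homomorphic s ρ) (embed-homomorphic t ρ)) (embed-∨ (⟦ s ⟧𝔹 ρ))
    where
    embed-∨ : ∀ b {c} → embed b ∨ embed c ≈ embed (b 𝔹.∨ c)
    embed-∨ true  = ∨-zeroˡ _
    embed-∨ false = ∨-identityˡ _
  embed-homomorphic (s ·ₜ t) ρ =
    trans (∙-cong (embed-homomorphic s ρ) (embed-homomorphic t ρ)) (embed-· (⟦ s ⟧𝔹 ρ))
    where
    embed-· : ∀ b {c} → embed b · embed c ≈ embed (b 𝔹.∧ c)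
    embed-· true  = identityˡ _
    embed-· false = ·-zeroˡ _
  embed-homomorphic (s ⇒ₜ t) ρ =
    trans (⇒-cong (embed-homomorphic s ρ) (embed-homomorphic t ρ)) (embed-⇒ (⟦ s ⟧𝔹 ρ))
    where
    embed-⇒ : ∀ b {c} → embed b ⇒ embed c ≈ embed (not b 𝔹.∨ c)
    embed-⇒ true  = ⇒-identityˡ _
    embed-⇒ false = ⊥⇒a≈⊤ _
  embed-homomorphic ⊥ₜ ρ = refl
  embed-homomorphic ⊤ₜ ρ = refl

  eval₁-at-⊥ : ∀ t {b} → valueAt⊥ t ≡ b → eval₁ t A ⊥ ≈ embed b
  eval₁-at-⊥ t ≡.refl = embed-homomorphic t (λ _ → false)

  ⟦⟧-resp-≗ : ∀ {n} (t : Term n) {ρ ρ′ : Fin n → Carrier} → ρ ≗ ρ′ → ⟦ t ⟧ A ρ ≡ ⟦ t ⟧ A ρ′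
  ⟦⟧-resp-≗ (var i)  ρ≗ρ′ = ρ≗ρ′ i
  ⟦⟧-resp-≗ (s ∧ₜ t) ρ≗ρ′ = ≡.cong₂ _∧_ (⟦⟧-resp-≗ s ρ≗ρ′) (⟦⟧-resp-≗ t ρ≗ρ′)
  ⟦⟧-resp-≗ (s ∨ₜ t) ρ≗ρ′ = ≡.cong₂ _∨_ (⟦⟧-resp-≗ s ρ≗ρ′) (⟦⟧-resp-≗ t ρ≗ρ′)
  ⟦⟧-resp-≗ (s ·ₜ t) ρ≗ρ′ = ≡.cong₂ _·_ (⟦⟧-resp-≗ s ρ≗ρ′) (⟦⟧-resp-≗ t ρ≗ρ′)
  ⟦⟧-resp-≗ (s ⇒ₜ t) ρ≗ρ′ = ≡.cong₂ _⇒_ (⟦⟧-resp-≗ s ρ≗ρ′) (⟦⟧-resp-≗ t ρ≗ρ′)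
  ⟦⟧-resp-≗ ⊥ₜ       ρ≗ρ′ = ≡.refl
  ⟦⟧-resp-≗ ⊤ₜ       ρ≗ρ′ = ≡.refl

  ⟦⟧≡eval₁ : ∀ (t : Term 1) ρ → ⟦ t ⟧ A ρ ≡ eval₁ t A (ρ zero)
  ⟦⟧≡eval₁ t ρ = ⟦⟧-resp-≗ t λ { zero → ≡.refl }

  module _ {γ : Carrier → Carrier} (γ-nucleus : IsNucleus A γ) where
    open IsNucleus γ-nucleus

    nucleus-≈⊤ : γ ⊥ ≈ ⊤ → ∀ a → γ a ≈ ⊤
    nucleus-≈⊤ γ⊥≈⊤ a = ≤-antisym (⊤-greatest (γ a)) (begin
      ⊤    ≈⟨ γ⊥≈⊤ ⟨
      γ ⊥  ≤⟨ monotone ⊥ a (⊥-least a) ⟩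
      γ a  ∎)

    nucleus-≤¬¬ : γ ⊥ ≈ ⊥ → ∀ a → γ a ≤ ¬ ¬ a
    nucleus-≤¬¬ γ⊥≈⊥ a = residuation₁ (γ a) (¬ a) ⊥ (begin
      γ a · ¬ a      ≤⟨ ·-monoʳ-≤ (γ a) (extensive (¬ a)) ⟩
      γ a · γ (¬ a)  ≤⟨ mult a (¬ a) ⟩
      γ (a · ¬ a)    ≤⟨ monotone (a · ¬ a) ⊥ (a·¬a≤⊥ a) ⟩
      γ ⊥            ≈⟨ γ⊥≈⊥ ⟩
      ⊥              ∎)

    nucleus-≈id : IsInvolutive A → γ ⊥ ≈ ⊥ → ∀ a → γ a ≈ a
    nucleus-≈id involutive γ⊥≈⊥ a = ≤-antisym
      (begin γ a ≤⟨ nucleus-≤¬¬ γ⊥≈⊥ a ⟩ ¬ ¬ a ≈⟨ involutive a ⟨ a ∎)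
      (extensive a)

  ≈id⇒isNucleus : ∀ {γ} → (∀ a → γ a ≈ a) → IsNucleus A γ
  ≈id⇒isNucleus {γ} γ≈id = record
    { extensive  = λ a → ≤-reflexive (sym (γ≈id a))
    ; monotone   = λ a b a≤b → begin γ a ≈⟨ γ≈id a ⟩ a ≤⟨ a≤b ⟩ b ≈⟨ γ≈id b ⟨ γ b ∎
    ; idempotent = λ a → γ≈id (γ a)
    ; mult       = λ a b → ≤-reflexive (trans (∙-cong (γ≈id a) (γ≈id b)) (sym (γ≈id (a · b))))
    }

  ≈⊤⇒isNucleus : ∀ {γ} → (∀ a → γ a ≈ ⊤) → IsNucleus A γ
  ≈⊤⇒isNucleus {γ} γ≈⊤ = record
    { extensive  = λ a → begin a ≤⟨ ⊤-greatest a ⟩ ⊤ ≈⟨ γ≈⊤ a ⟨ γ a ∎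
    ; monotone   = λ a b _ → ≤-reflexive (trans (γ≈⊤ a) (sym (γ≈⊤ b)))
    ; idempotent = λ a → trans (γ≈⊤ (γ a)) (sym (γ≈⊤ a))
    ; mult       = λ a b → ≤-reflexive (begin-equality
        γ a · γ b  ≈⟨ ∙-cong (γ≈⊤ a) (γ≈⊤ b) ⟩
        ⊤ · ⊤      ≈⟨ identityˡ ⊤ ⟩
        ⊤          ≈⟨ γ≈⊤ (a · b) ⟨
        γ (a · b)  ∎)
    }

module _ (V : Subvariety) (t : Term 1) where
  open ResLatticeProperties
  open ResLattice using (_≈_)
  private
    module Eq (A : ResLattice) = IsLattice (ResLattice.isLattice A)

  ⊨ᵥ-unary : ∀ s → (∀ A → A ∈ᵥ V → ∀ a → _≈_ A (eval₁ t A a) (eval₁ s A a)) → V ⊨ᵥ t ≈ s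
  ⊨ᵥ-unary s t≈s A A∈V ρ rewrite ⟦⟧≡eval₁ A t ρ | ⟦⟧≡eval₁ A s ρ = t≈s A A∈V (ρ zero)

  ≈x⇔≈¬¬x : (V ⊨ᵥ t ≈ x₁) ⇔ (V ⊨ᵥ t ≈ ¬¬x₁)
  ≈x⇔≈¬¬x = mk⇔
    (λ t≈x A A∈V@(involutive , _) ρ → Eq.trans A (t≈x A A∈V ρ) (involutive (ρ zero)))
    (λ t≈¬¬x A A∈V@(involutive , _) ρ →
       Eq.trans A (t≈¬¬x A A∈V ρ) (Eq.sym A (involutive (ρ zero))))

  nucleusOn⇒≈x⊎≈⊤ : NucleusOn V t → (V ⊨ᵥ t ≈ x₁) ⊎ (V ⊨ᵥ t ≈ ⊤₁)
  nucleusOn⇒≈x⊎≈⊤ nucleus with valueAt⊥ t in t⊥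
  ... | false = inj₁ (⊨ᵥ-unary x₁ λ A A∈V@(involutive , _) →
                  nucleus-≈id A (nucleus A A∈V) involutive (eval₁-at-⊥ A t t⊥))
  ... | true  = inj₂ (⊨ᵥ-unary ⊤₁ λ A A∈V →
                  nucleus-≈⊤ A (nucleus A A∈V) (eval₁-at-⊥ A t t⊥))

  ≈x⊎≈⊤⇒nucleusOn : (V ⊨ᵥ t ≈ x₁) ⊎ (V ⊨ᵥ t ≈ ⊤₁) → NucleusOn V t
  ≈x⊎≈⊤⇒nucleusOn (inj₁ t≈x) A A∈V = ≈id⇒isNucleus A λ a → t≈x A A∈V (λ _ → a)
  ≈x⊎≈⊤⇒nucleusOn (inj₂ t≈⊤) A A∈V = ≈⊤⇒isNucleus A λ a → t≈⊤ A A∈V (λ _ → a)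

  nucleusOn⇔≈x⊎≈⊤ : NucleusOn V t ⇔ ((V ⊨ᵥ t ≈ x₁) ⊎ (V ⊨ᵥ t ≈ ⊤₁))
  nucleusOn⇔≈x⊎≈⊤ = mk⇔ nucleusOn⇒≈x⊎≈⊤ ≈x⊎≈⊤⇒nucleusOn

mainTheorem9 : (V : Subvariety) (t : Term 1) →
    (NucleusOn V t ⇔ ((V ⊨ᵥ t ≈ x₁) ⊎ (V ⊨ᵥ t ≈ ⊤₁)))
    × (NucleusOn V t ⇔ ((V ⊨ᵥ t ≈ ¬¬x₁) ⊎ (V ⊨ᵥ t ≈ ⊤₁)))
mainTheorem9 V t =
  nucleusOn⇔≈x⊎≈⊤ V t , (≈x⇔≈¬¬x V t ⊎-⇔ ⇔-id _) ⇔-∘ nucleusOn⇔≈x⊎≈⊤ V t
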